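{- Let $n\geq 4$, $k\geq 5$, and let $f_1^{n,k},\dots,f_n^{n,k}$ be a valid dynamic task allocation with maximum switching cost at most $2$. Let $t$ be a task of type 2 with intermediate task $i$ with respect to a demand vector $\vec v$, and suppose $\vec v$ has at least one unit of demand in each of two tasks $s_1,s_2$, both distinct from $t$ and $i$. Let $\vec v'$ be the demand vector such that $(\vec v,\vec v')$ is $(i,t)$-adjacent. Then $(\vec v,\vec v')$ has switching cost $1$.
   Context: A demand vector for $n$ agents and $k$ tasks is $\vec v=(v_1,\dots,v_k)$ of non-negative integers summing to $n$. A valid dynamic task allocation is a family of functions $f_1^{n,k},\dots,f_n^{n,k}$ from demand vectors to $[k]$ such that for every $\vec v$ and task $j$, exactly $v_j$ agents $a$ have $f_a^{n,k}(\vec v)=j$. The switching cost of $(\vec v,\vec v')$ is the number of agents $a$ with $f_a^{n,k}(\vec v)\neq f_a^{n,k}(\vec v')$; the maximum switching cost is its maximum over pairs at $\ell_1$ distance $2$. $(\vec v_1,\vec v_2)$ is $(s,t)$-adjacent if $\vec v_2$ is obtained from $\vec v_1$ by moving one unit of demand from task $s$ to task $t\neq s$. Agent $a$ is $(i,j)$-mobile for $(\vec v_1,\vec v_2)$ if $f_a^{n,k}(\vec v_1)=i\neq j=f_a^{n,k}(\vec v_2)$. If $(\vec v_1,\vec v_2)$ is $(s,t)$-adjacent with switching cost $2$, its intermediate task is the task $i$ such that one agent is $(s,i)$-mobile and another is $(i,t)$-mobile. A task $t$ is of type 2 with respect to $\vec v$ if there exist a task $i$ and an agent $a$ such that moving a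 unit of demand in $\vec v$ from any task other than $i$ to $t$ yields switching cost $2$, intermediate task $i$, and $(i,t)$-mobile agent $a$; $i$ is the intermediate task of $t$ with respect to $\vec v$. -}

module Defs where

open import Data.Nat using (ℕ; zero; suc; _+_; _≤_; ∣_-_∣)
open import Data.Fin using (Fin; _≟_)
open import Data.Vec using (Vec; lookup; sum; zipWith)
open import Data.List using (List; length; filter)
open import Data.List using () renaming (allFin to allFinL)
open import Data.Product using (Σ; ∃; _×_)
open import Relation.Nullary using (¬_; ¬?)
open import Relation.Binary.PropositionalEquality using (_≡_; _≢_)

Demand : ℕ → Set
Demand k = Vec ℕ k

IsDemandVector : (n k : ℕ) → Demand k → Set
IsDemandVector n k v = sum v ≡ n

-- A family of functions f_a : demand vectors → tasks, one per agent a.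
-- (Defined on all of Vec ℕ k; only values on demand vectors matter.)
Allocation : ℕ → ℕ → Set
Allocation n k = Fin n → Demand k → Fin k

load : ∀ {n k} → Allocation n k → Demand k → Fin k → ℕ
load {n} f v j = length (filter (λ a → f a v ≟ j) (allFinL n))

Valid : ∀ {n k} → Allocation n k → Set
Valid {n} {k} f = ∀ (v : Demand k) → IsDemandVector n k v → ∀ (j : Fin k) → load f v j ≡ lookup v j

switchCost : ∀ {n k} → Allocation n k → Demand k → Demand k → ℕ
switchCost {n} f v v' = length (filter (λ a → ¬? (f a v ≟ f a v')) (allFinL n))

dist1 : ∀ {k} → Demand k → Demand k → ℕ
dist1 v v' = sum (zipWith ∣_-_∣ v v')

MaxSwitchCostAtMost : ∀ {n k} → Allocation n k → ℕ → Set
MaxSwitchCostAtMost {n} {k} f c =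
  ∀ (v v' : Demand k) → IsDemandVector n k v → IsDemandVector n k v' →
  dist1 v v' ≡ 2 → switchCost f v v' ≤ c

Adjacent : ∀ {k} → Fin k → Fin k → Demand k → Demand k → Set
Adjacent s t v1 v2 =
  s ≢ t × suc (lookup v2 s) ≡ lookup v1 s × lookup v2 t ≡ suc (lookup v1 t) ×
  (∀ j → j ≢ s → j ≢ t → lookup v2 j ≡ lookup v1 j)

Mobile : ∀ {n k} → Allocation n k → Fin n → Fin k → Fin k → Demand k → Demand k → Set
Mobile f a i j v1 v2 = f a v1 ≡ i × i ≢ j × f a v2 ≡ j

IsIntermediate : ∀ {n k} → Allocation n k → Fin k → Fin k → Fin k → Demand k → Demand k → Set
IsIntermediate {n} f s t i v1 v2 =
  Adjacent s t v1 v2 × switchCost f v1 v2 ≡ 2 ×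
  Σ (Fin n) (λ a → Σ (Fin n) (λ b → a ≢ b × Mobile f a s i v1 v2 × Mobile f b i t v1 v2))

Type2With : ∀ {n k} → Allocation n k → Demand k → Fin k → Fin k → Set
Type2With {n} {k} f v t i =
  Σ (Fin n) (λ a →
    ∀ (s : Fin k) → s ≢ i → ∀ (v' : Demand k) → IsDemandVector n k v' → Adjacent s t v v' →
      IsIntermediate f s t i v v' × Mobile f a i t v v')

module Submission where

-- Moving one unit from i to t changes the loads, so some agent switches, and the cost is at most 2;
-- it remains to exclude cost 2. Counting loads task by task, the two switching agents of a cost-2
-- move then form a chain i → m → t through an intermediate task m. Comparing that move with the
-- move of a unit from another source s to t, which by type 2 passes through i, shows that m must
-- be s for every task s ∉ {i, t} with positive demand. Two such tasks s₁ ≠ s₂ cannot both be m.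

open import Defs
open import Data.Nat using (ℕ; _≤_; _≥_; suc; _+_; pred; ∣_-_∣; s≤s; z≤n)
open import Data.Nat.Properties
  using (+-comm; +-assoc; +-identityʳ; 0≢1+n; +-suc; +-cancelˡ-≡; ≤-reflexive; n≤1+n; m+n∸n≡m;
         ∣n-n∣≡0; m≤n⇒∣m-n∣≡n∸m; m≤n⇒∣n-m∣≡n∸m; suc-injective; +-commutativeSemigroup)
open import Algebra.Properties.CommutativeSemigroup +-commutativeSemigroup using (interchange)
open import Data.Fin using (Fin; _≟_) renaming (zero to fzero; suc to fsuc)
open import Data.Vec using (Vec; lookup; sum; updateAt; tabulate; _∷_; [])
open import Data.Vec.Properties using (lookup∘updateAt; lookup∘updateAt′; tabulate∘lookup; tabulate-cong)
open import Data.List using (List; length; filter; allFin; []; _∷_)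
open import Data.List.Membership.Propositional using (_∈_)
open import Data.List.Membership.Propositional.Properties using (∈-filter⁺; ∈-filter⁻; ∈-allFin)
open import Data.List.Relation.Unary.Any using (here; there)
open import Data.List.Relation.Unary.All using () renaming (_∷_ to _∷ᴬ_)
open import Data.List.Relation.Unary.AllPairs using () renaming (_∷_ to _∷ᴾ_)
open import Data.List.Relation.Unary.Unique.Propositional using (Unique)
open import Data.List.Relation.Unary.Unique.Propositional.Properties using (allFin⁺; filter⁺)
open import Data.Bool using (if_then_else_)
open import Data.Product using (Σ; _×_; _,_; proj₁; proj₂; swap)
open import Data.Sum using (_⊎_; inj₁; inj₂)
open import Data.Empty using (⊥; ⊥-elim)
open import Relation.Nullary using (¬?; does; yes; no)
open import Relation.Nullary.Decidable using (decidable-stable)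
open import Relation.Binary.Definitions using (DecidableEquality)
open import Relation.Binary.PropositionalEquality
  using (_≡_; _≢_; ≢-sym; refl; sym; trans; cong; cong₂; subst; module ≡-Reasoning)

open ≡-Reasoning

∣n-1+n∣≡1 : ∀ n → ∣ n - suc n ∣ ≡ 1
∣n-1+n∣≡1 n = trans (m≤n⇒∣m-n∣≡n∸m (n≤1+n n)) (m+n∸n≡m 1 n)

∣1+n-n∣≡1 : ∀ n → ∣ suc n - n ∣ ≡ 1
∣1+n-n∣≡1 n = trans (m≤n⇒∣n-m∣≡n∸m (n≤1+n n)) (m+n∸n≡m 1 n)

lookup-ext : ∀ {k} {x y : Vec ℕ k} → (∀ j → lookup x j ≡ lookup y j) → x ≡ y
lookup-ext {x = x} {y} eq = begin
  x                  ≡⟨ sym (tabulate∘lookup x) ⟩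
  tabulate (lookup x) ≡⟨ tabulate-cong eq ⟩
  tabulate (lookup y) ≡⟨ tabulate∘lookup y ⟩
  y                  ∎

move : ∀ {k} → Demand k → Fin k → Fin k → Demand k
move x s t = updateAt (updateAt x s pred) t suc

module _ {k : ℕ} {s t : Fin k} where

  move-adjacent : ∀ (x : Demand k) → s ≢ t → lookup x s ≥ 1 → Adjacent s t x (move x s t)
  move-adjacent x s≢t xₛ≥1 = s≢t , source , target , other
    where
    source : suc (lookup (move x s t) s) ≡ lookup x s
    source = begin
      suc (lookup (move x s t) s)          ≡⟨ cong suc (lookup∘updateAt′ s t s≢t (updateAt x s pred)) ⟩
      suc (lookup (updateAt x s pred) s)   ≡⟨ cong suc (lookup∘updateAt s x) ⟩
      suc (pred (lookup x s))              ≡⟨ suc-pred xₛ≥1 ⟩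
      lookup x s                           ∎
      where
      suc-pred : ∀ {m} → m ≥ 1 → suc (pred m) ≡ m
      suc-pred (s≤s _) = refl
    target : lookup (move x s t) t ≡ suc (lookup x t)
    target = trans (lookup∘updateAt t (updateAt x s pred))
                   (cong suc (lookup∘updateAt′ t s (≢-sym s≢t) x))
    other : ∀ j → j ≢ s → j ≢ t → lookup (move x s t) j ≡ lookup x j
    other j j≢s j≢t = trans (lookup∘updateAt′ j t j≢t (updateAt x s pred)) (lookup∘updateAt′ j s j≢s x)

  adjacent-unique : ∀ {x y z : Demand k} → Adjacent s t x y → Adjacent s t x z → y ≡ z
  adjacent-unique {x} {y} {z} (s≢t , yₛ , yₜ , yⱼ) (_ , zₛ , zₜ , zⱼ) = lookup-ext pointwise
    where
    pointwise : ∀ j → lookup y j ≡ lookup z j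
    pointwise j with j ≟ s | j ≟ t
    ... | yes refl | _        = suc-injective (trans yₛ (sym zₛ))
    ... | no _     | yes refl = trans yₜ (sym zₜ)
    ... | no j≢s   | no j≢t   = trans (yⱼ j j≢s j≢t) (sym (zⱼ j j≢s j≢t))

  adjacent-source≥1 : ∀ {x y : Demand k} → Adjacent s t x y → lookup x s ≥ 1
  adjacent-source≥1 (_ , yₛ , _) = subst (_≥ 1) yₛ (s≤s z≤n)

  adjacent⇒≡move : ∀ {x y : Demand k} → Adjacent s t x y → y ≡ move x s t
  adjacent⇒≡move {x} {y} adj =
    adjacent-unique {x = x} adj (move-adjacent x (proj₁ adj) (adjacent-source≥1 {x} {y} adj))

sum-updateAt-suc : ∀ {k} (x : Vec ℕ k) j → sum (updateAt x j suc) ≡ suc (sum x)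
sum-updateAt-suc (a ∷ x) fzero    = refl
sum-updateAt-suc (a ∷ x) (fsuc j) = trans (cong (a +_) (sum-updateAt-suc x j)) (+-suc a (sum x))

sum-updateAt-pred : ∀ {k} (x : Vec ℕ k) j → lookup x j ≥ 1 → suc (sum (updateAt x j pred)) ≡ sum x
sum-updateAt-pred (suc a ∷ x) fzero    _    = refl
sum-updateAt-pred (a ∷ x)     (fsuc j) xⱼ≥1 =
  trans (sym (+-suc a _)) (cong (a +_) (sum-updateAt-pred x j xⱼ≥1))

sum-move : ∀ {k} (x : Demand k) s t → lookup x s ≥ 1 → sum (move x s t) ≡ sum x
sum-move x s t xₛ≥1 = trans (sum-updateAt-suc (updateAt x s pred) t) (sum-updateAt-pred x s xₛ≥1)

dist1-self : ∀ {k} (x : Vec ℕ k) → dist1 x x ≡ 0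
dist1-self []      = refl
dist1-self (a ∷ x) = cong₂ _+_ (∣n-n∣≡0 a) (dist1-self x)

dist1-updateAt : ∀ {k} (x : Vec ℕ k) j f → dist1 x (updateAt x j f) ≡ ∣ lookup x j - f (lookup x j) ∣
dist1-updateAt (a ∷ x) fzero    f = trans (cong (∣ a - f a ∣ +_) (dist1-self x)) (+-identityʳ _)
dist1-updateAt (a ∷ x) (fsuc j) f = trans (cong (_+ dist1 x (updateAt x j f)) (∣n-n∣≡0 a)) (dist1-updateAt x j f)

dist1-move : ∀ {k} (x : Demand k) s t → s ≢ t → lookup x s ≥ 1 → dist1 x (move x s t) ≡ 2
dist1-move (a ∷ x)     fzero    fzero    s≢t _    = ⊥-elim (s≢t refl)
dist1-move (suc a ∷ x) fzero    (fsuc t) _   _    =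
  cong₂ _+_ (∣1+n-n∣≡1 a) (trans (dist1-updateAt x t suc) (∣n-1+n∣≡1 (lookup x t)))
dist1-move (a ∷ x)     (fsuc s) fzero    _   xₛ≥1 =
  trans (cong₂ _+_ (∣n-1+n∣≡1 a) (dist1-updateAt x s pred)) (cong suc (pred-step xₛ≥1))
  where
  pred-step : ∀ {m} → m ≥ 1 → ∣ m - pred m ∣ ≡ 1
  pred-step {suc m} _ = ∣1+n-n∣≡1 m
dist1-move (a ∷ x)     (fsuc s) (fsuc t) s≢t xₛ≥1 =
  cong₂ _+_ (∣n-n∣≡0 a) (dist1-move x s t (λ e → s≢t (cong fsuc e)) xₛ≥1)

adjacent⇒dist1≡2 : ∀ {k} {s t : Fin k} {x y : Demand k} → Adjacent s t x y → dist1 x y ≡ 2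
adjacent⇒dist1≡2 {s = s} {t} {x} {y} adj =
  subst (λ y → dist1 x y ≡ 2) (sym (adjacent⇒≡move {x = x} {y} adj))
        (dist1-move x s t (proj₁ adj) (adjacent-source≥1 {x = x} {y} adj))

adjacent-reroute : ∀ {k} {s t i : Fin k} {v u w : Demand k} →
  Adjacent i t v u → Adjacent s t v w → s ≢ i → Adjacent s i u w
adjacent-reroute {s = s} {t} {i} {v} {u} {w} (i≢t , uᵢ , uₜ , uⱼ) (s≢t , wₛ , wₜ , wⱼ) s≢i =
  s≢i , source , target , other
  where
  source : suc (lookup w s) ≡ lookup u s
  source = trans wₛ (sym (uⱼ s s≢i s≢t))
  target : lookup w i ≡ suc (lookup u i)
  target = trans (wⱼ i (≢-sym s≢i) i≢t) (sym uᵢ)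
  other : ∀ j → j ≢ s → j ≢ i → lookup w j ≡ lookup u j
  other j j≢s j≢i with j ≟ t
  ... | yes refl = trans wₜ (sym uₜ)
  ... | no j≢t   = trans (wⱼ j j≢s j≢t) (sym (uⱼ j j≢i j≢t))

cancel-head : ∀ a b c {r} → a + b + c ≡ a + r → b + c ≡ r
cancel-head a b c eq = +-cancelˡ-≡ a _ _ (trans (sym (+-assoc a b c)) eq)

module Multiplicity {A : Set} (_≟ᴬ_ : DecidableEquality A) where

  δ : A → A → ℕ
  δ a b = if does (a ≟ᴬ b) then 1 else 0

  δ-refl : ∀ a → δ a a ≡ 1
  δ-refl a with a ≟ᴬ a
  ... | yes _   = refl
  ... | no a≢a = ⊥-elim (a≢a refl)

  δ-≢ : ∀ {a b} → a ≢ b → δ a b ≡ 0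
  δ-≢ {a} {b} a≢b with a ≟ᴬ b
  ... | yes a≡b = ⊥-elim (a≢b a≡b)
  ... | no _    = refl

  δ≡suc⇒≡ : ∀ {a b m} → δ a b ≡ suc m → a ≡ b
  δ≡suc⇒≡ {a} {b} eq with a ≟ᴬ b
  ... | yes a≡b = a≡b
  ... | no _    = ⊥-elim (0≢1+n eq)

  -- Equality of two- and of three-element multisets, compared through multiplicities.
  SameTwo : A → A → A → A → Set
  SameTwo x₁ x₂ y₁ y₂ = ∀ j → δ x₁ j + δ x₂ j ≡ δ y₁ j + δ y₂ j

  SameThree : A → A → A → A → A → A → Set
  SameThree x₁ x₂ x₃ y₁ y₂ y₃ = ∀ j → δ x₁ j + δ x₂ j + δ x₃ j ≡ δ y₁ j + δ y₂ j + δ y₃ j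

  sameTwo-aligned : ∀ {x₁ x₂ y₁ y₂} → SameTwo x₁ x₂ y₁ y₂ → x₁ ≢ y₂ → x₁ ≡ y₁ × x₂ ≡ y₂
  sameTwo-aligned {x₁} {x₂} {y₁} {y₂} same x₁≢y₂ with y₁≡x₁
    where
    y₁≡x₁ : y₁ ≡ x₁
    y₁≡x₁ = δ≡suc⇒≡ (begin
      δ y₁ x₁              ≡⟨ sym (+-identityʳ _) ⟩
      δ y₁ x₁ + 0          ≡⟨ cong (δ y₁ x₁ +_) (sym (δ-≢ (≢-sym x₁≢y₂))) ⟩
      δ y₁ x₁ + δ y₂ x₁    ≡⟨ sym (same x₁) ⟩
      δ x₁ x₁ + δ x₂ x₁    ≡⟨ cong (_+ δ x₂ x₁) (δ-refl x₁) ⟩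
      suc (δ x₂ x₁)        ∎)
  ... | refl = refl , sym (δ≡suc⇒≡ (begin
      δ y₂ x₂              ≡⟨ sym (+-cancelˡ-≡ (δ x₁ x₂) _ _ (same x₂)) ⟩
      δ x₂ x₂              ≡⟨ δ-refl x₂ ⟩
      1                    ∎))

  sameThree-derangement : ∀ {x₁ x₂ x₃ y₁ y₂ y₃} → SameThree x₁ x₂ x₃ y₁ y₂ y₃ →
    x₁ ≢ y₁ → x₂ ≢ y₂ → x₃ ≢ y₃ →
    (x₁ ≡ y₂ × x₂ ≡ y₃ × x₃ ≡ y₁) ⊎ (x₁ ≡ y₃ × x₂ ≡ y₁ × x₃ ≡ y₂)
  sameThree-derangement {x₁} {x₂} {x₃} {y₁} {y₂} {y₃} same x₁≢y₁ x₂≢y₂ x₃≢y₃ with y₂ ≟ᴬ x₁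
  ... | yes refl = inj₁ (refl , swap (sameTwo-aligned rest x₃≢y₃))
    where
    rest : SameTwo x₃ x₂ y₁ y₃
    rest j = trans (+-comm (δ x₃ j) (δ x₂ j)) (cancel-head (δ x₁ j) (δ x₂ j) (δ x₃ j) (begin
      δ x₁ j + δ x₂ j + δ x₃ j    ≡⟨ same j ⟩
      δ y₁ j + δ x₁ j + δ y₃ j    ≡⟨ cong (_+ δ y₃ j) (+-comm (δ y₁ j) (δ x₁ j)) ⟩
      δ x₁ j + δ y₁ j + δ y₃ j    ≡⟨ +-assoc (δ x₁ j) _ _ ⟩
      δ x₁ j + (δ y₁ j + δ y₃ j)  ∎))
  ... | no y₂≢x₁ = via-y₃ y₃≡x₁
    where
    y₃≡x₁ : y₃ ≡ x₁
    y₃≡x₁ = δ≡suc⇒≡ (+-cancelˡ-≡ (δ y₁ x₁ + δ y₂ x₁) _ _ (begin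
      δ y₁ x₁ + δ y₂ x₁ + δ y₃ x₁  ≡⟨ sym (same x₁) ⟩
      δ x₁ x₁ + δ x₂ x₁ + δ x₃ x₁  ≡⟨ cong (λ z → z + δ x₂ x₁ + δ x₃ x₁) (δ-refl x₁) ⟩
      suc (δ x₂ x₁ + δ x₃ x₁)      ≡⟨ cong₂ (λ p q → p + q + suc _) (sym (δ-≢ (≢-sym x₁≢y₁))) (sym (δ-≢ y₂≢x₁)) ⟩
      δ y₁ x₁ + δ y₂ x₁ + suc (δ x₂ x₁ + δ x₃ x₁) ∎))
    via-y₃ : y₃ ≡ x₁ → (x₁ ≡ y₂ × x₂ ≡ y₃ × x₃ ≡ y₁) ⊎ (x₁ ≡ y₃ × x₂ ≡ y₁ × x₃ ≡ y₂)
    via-y₃ refl = inj₂ (refl , sameTwo-aligned rest x₂≢y₂)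
      where
      rest : SameTwo x₂ x₃ y₁ y₂
      rest j = cancel-head (δ x₁ j) (δ x₂ j) (δ x₃ j) (trans (same j) (+-comm (δ y₁ j + δ y₂ j) (δ x₁ j)))

private
  module FinMultiplicity {k : ℕ} = Multiplicity (_≟_ {k})
open FinMultiplicity

adjacent-balance : ∀ {k} {s t : Fin k} {x y : Demand k} → Adjacent s t x y →
  ∀ j → lookup y j + δ s j ≡ lookup x j + δ t j
adjacent-balance {s = s} {t} {x} {y} (s≢t , yₛ , yₜ , yⱼ) j with s ≟ j | t ≟ j
... | yes refl | yes refl = ⊥-elim (s≢t refl)
... | yes refl | no _     = trans (+-comm (lookup y s) 1) (trans yₛ (sym (+-identityʳ _)))
... | no _     | yes refl = trans (+-identityʳ _) (trans yₜ (+-comm 1 (lookup x t)))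
... | no s≢j   | no t≢j   = cong (_+ 0) (yⱼ j (≢-sym s≢j) (≢-sym t≢j))

length≤2⇒∈-pair : ∀ {A : Set} {x y z : A} (xs : List A) → length xs ≤ 2 → x ≢ y →
  x ∈ xs → y ∈ xs → z ∈ xs → z ≡ x ⊎ z ≡ y
length≤2⇒∈-pair (_ ∷ _ ∷ _ ∷ _) (s≤s (s≤s ())) _ _ _ _
length≤2⇒∈-pair (_ ∷ [])     _ x≢y (here refl) (here refl) _ = ⊥-elim (x≢y refl)
length≤2⇒∈-pair (_ ∷ _ ∷ []) _ x≢y (here refl) (here refl) _ = ⊥-elim (x≢y refl)
length≤2⇒∈-pair (_ ∷ _ ∷ []) _ x≢y (there (here refl)) (there (here refl)) _ = ⊥-elim (x≢y refl)
length≤2⇒∈-pair (_ ∷ _ ∷ []) _ _ (here refl) (there (here refl)) (here refl) = inj₁ refl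
length≤2⇒∈-pair (_ ∷ _ ∷ []) _ _ (here refl) (there (here refl)) (there (here refl)) = inj₂ refl
length≤2⇒∈-pair (_ ∷ _ ∷ []) _ _ (there (here refl)) (here refl) (here refl) = inj₂ refl
length≤2⇒∈-pair (_ ∷ _ ∷ []) _ _ (there (here refl)) (here refl) (there (here refl)) = inj₁ refl

module _ {A : Set} {k : ℕ} where

  count : (A → Fin k) → List A → Fin k → ℕ
  count g xs j = length (filter (λ x → g x ≟ j) xs)

  switched : (g h : A → Fin k) → List A → List A
  switched g h = filter (λ x → ¬? (g x ≟ h x))

  -- Non-switched elements are counted identically by g and h.
  count-switched : ∀ (g h : A → Fin k) j xs →
    count h xs j + count g (switched g h xs) j ≡ count g xs j + count h (switched g h xs) j
  count-switched g h j [] = refl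
  count-switched g h j (x ∷ xs) with g x ≟ h x
  ... | yes g≡h with g x ≟ j | h x ≟ j
  ...   | yes _   | yes _   = cong suc (count-switched g h j xs)
  ...   | yes g≡j | no h≢j  = ⊥-elim (h≢j (trans (sym g≡h) g≡j))
  ...   | no g≢j  | yes h≡j = ⊥-elim (g≢j (trans g≡h h≡j))
  ...   | no _    | no _    = count-switched g h j xs
  count-switched g h j (x ∷ xs) | no g≢h with g x ≟ j | h x ≟ j
  ...   | yes g≡j | yes h≡j = ⊥-elim (g≢h (trans g≡j (sym h≡j)))
  ...   | yes _   | no _    = trans (+-suc _ _) (cong suc (count-switched g h j xs))
  ...   | no _    | yes _   = trans (cong suc (count-switched g h j xs)) (sym (+-suc _ _))
  ...   | no _    | no _    = count-switched g h j xs

  count-∷ : ∀ (g : A → Fin k) x xs j → count g (x ∷ xs) j ≡ δ (g x) j + count g xs j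
  count-∷ g x xs j with g x ≟ j
  ... | yes _ = refl
  ... | no _  = refl

  count-pair : ∀ (g : A → Fin k) c d j → count g (c ∷ d ∷ []) j ≡ δ (g c) j + δ (g d) j
  count-pair g c d j = begin
    count g (c ∷ d ∷ []) j          ≡⟨ count-∷ g c (d ∷ []) j ⟩
    δ (g c) j + count g (d ∷ []) j  ≡⟨ cong (δ (g c) j +_) (count-∷ g d [] j) ⟩
    δ (g c) j + (δ (g d) j + 0)     ≡⟨ cong (δ (g c) j +_) (+-identityʳ _) ⟩
    δ (g c) j + δ (g d) j           ∎

module _ {n k : ℕ} (f : Allocation n k) where

  switchers : Demand k → Demand k → List (Fin n)
  switchers v w = switched (λ a → f a v) (λ a → f a w) (allFin n)

  switcher∈switchers : ∀ {v w a} → f a v ≢ f a w → a ∈ switchers v w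
  switcher∈switchers {v} {w} {a} = ∈-filter⁺ (λ a → ¬? (f a v ≟ f a w)) (∈-allFin a)

  mobile⇒switcher : ∀ {a p q v w} → Mobile f a p q v w → f a v ≢ f a w
  mobile⇒switcher (aᵛ≡p , p≢q , aʷ≡q) aᵛ≡aʷ = p≢q (trans (sym aᵛ≡p) (trans aᵛ≡aʷ aʷ≡q))

  switcher⇒mobile : ∀ {a p q v w} → f a v ≢ f a w → f a v ≡ p → f a w ≡ q → Mobile f a p q v w
  switcher⇒mobile sw aᵛ≡p aʷ≡q = aᵛ≡p , (λ p≡q → sw (trans aᵛ≡p (trans p≡q (sym aʷ≡q)))) , aʷ≡q

  at-distinct-tasks⇒≢ : ∀ {v a b p q} → f a v ≡ p → f b v ≡ q → p ≢ q → a ≢ b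
  at-distinct-tasks⇒≢ refl refl p≢q refl = p≢q refl

  unswitched : ∀ {v w a b z} → switchCost f v w ≤ 2 → a ≢ b → f a v ≢ f a w → f b v ≢ f b w →
    z ≢ a → z ≢ b → f z v ≡ f z w
  unswitched {v} {w} {z = z} cost a≢b swa swb z≢a z≢b with f z v ≟ f z w
  ... | yes same = same
  ... | no swz with length≤2⇒∈-pair (switchers v w) cost a≢b
                      (switcher∈switchers swa) (switcher∈switchers swb) (switcher∈switchers swz)
  ...   | inj₁ z≡a = ⊥-elim (z≢a z≡a)
  ...   | inj₂ z≡b = ⊥-elim (z≢b z≡b)

  module _ (valid : Valid f) {v w : Demand k} (dv : IsDemandVector n k v) (dw : IsDemandVector n k w) where

    private
      g h : Fin n → Fin k
      g a = f a v
      h a = f a w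

    load-balance : ∀ j → lookup w j + count g (switchers v w) j ≡ lookup v j + count h (switchers v w) j
    load-balance j = begin
      lookup w j + count g (switchers v w) j  ≡⟨ cong (_+ count g (switchers v w) j) (sym (valid w dw j)) ⟩
      load f w j + count g (switchers v w) j  ≡⟨ count-switched g h j (allFin n) ⟩
      load f v j + count h (switchers v w) j  ≡⟨ cong (_+ count h (switchers v w) j) (valid v dv j) ⟩
      lookup v j + count h (switchers v w) j  ∎

    switchers-balance : ∀ {s t} → Adjacent s t v w →
      ∀ j → count g (switchers v w) j + δ t j ≡ count h (switchers v w) j + δ s j
    switchers-balance {s} {t} adj j =
      balance (lookup w j) (count g (switchers v w) j) (lookup v j) (count h (switchers v w) j) (δ s j) (δ t j)
        (load-balance j) (adjacent-balance {x = v} {y = w} adj j)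
      where
      balance : ∀ a b c d e f → a + b ≡ c + d → a + e ≡ c + f → b + f ≡ d + e
      balance a b c d e f ab≡cd ae≡cf = +-cancelˡ-≡ (a + c) _ _ (begin
        (a + c) + (b + f)  ≡⟨ interchange a c b f ⟩
        (a + b) + (c + f)  ≡⟨ cong₂ _+_ ab≡cd (sym ae≡cf) ⟩
        (c + d) + (a + e)  ≡⟨ interchange c d a e ⟩
        (c + a) + (d + e)  ≡⟨ cong (_+ (d + e)) (+-comm c a) ⟩
        (a + c) + (d + e)  ∎)

    adjacent⇒switchCost≢0 : ∀ {s t} → Adjacent s t v w → switchCost f v w ≢ 0
    adjacent⇒switchCost≢0 {s} {t} adj = no-switchers (switchers v w) refl
      where
      no-switchers : ∀ L → switchers v w ≡ L → length L ≢ 0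
      no-switchers [] eq _ = proj₁ adj (δ≡suc⇒≡ (begin
        δ s t  ≡⟨ sym (subst (λ L → count g L t + δ t t ≡ count h L t + δ s t) eq (switchers-balance adj t)) ⟩
        δ t t  ≡⟨ δ-refl t ⟩
        1      ∎))
      no-switchers (_ ∷ _) _ ()

    adjacent-switchCost≡2⇒intermediate : ∀ {s t} → Adjacent s t v w → switchCost f v w ≡ 2 →
      Σ (Fin k) λ m → IsIntermediate f s t m v w
    adjacent-switchCost≡2⇒intermediate {s} {t} adj cost≡2 = two-switchers (switchers v w) refl cost≡2
      where
      two-switchers : ∀ L → switchers v w ≡ L → length L ≡ 2 → Σ (Fin k) λ m → IsIntermediate f s t m v w
      two-switchers (c ∷ d ∷ []) eq _ =
        from-cycle (sameThree-derangement same swc swd (≢-sym (proj₁ adj)))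
        where
        distinct : Unique (c ∷ d ∷ []) → c ≢ d
        distinct ((c≢d ∷ᴬ _) ∷ᴾ _) = c≢d
        c≢d : c ≢ d
        c≢d = distinct (subst Unique eq (filter⁺ _ (allFin⁺ n)))
        swc : g c ≢ h c
        swc = proj₂ (∈-filter⁻ _ {xs = allFin n} (subst (c ∈_) (sym eq) (here refl)))
        swd : g d ≢ h d
        swd = proj₂ (∈-filter⁻ _ {xs = allFin n} (subst (d ∈_) (sym eq) (there (here refl))))
        same : SameThree (g c) (g d) t (h c) (h d) s
        same j = begin
          δ (g c) j + δ (g d) j + δ t j   ≡⟨ cong (_+ δ t j) (sym (count-pair g c d j)) ⟩
          count g (c ∷ d ∷ []) j + δ t j  ≡⟨ subst (λ L → count g L j + δ t j ≡ count h L j + δ s j) eq (switchers-balance adj j) ⟩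
          count h (c ∷ d ∷ []) j + δ s j  ≡⟨ cong (_+ δ s j) (count-pair h c d j) ⟩
          δ (h c) j + δ (h d) j + δ s j   ∎
        from-cycle : (g c ≡ h d × g d ≡ s × t ≡ h c) ⊎ (g c ≡ s × g d ≡ h c × t ≡ h d) →
          Σ (Fin k) λ m → IsIntermediate f s t m v w
        from-cycle (inj₁ (gc≡hd , gd≡s , t≡hc)) =
          g c , adj , cost≡2 , d , c , (≢-sym c≢d) ,
          switcher⇒mobile swd gd≡s (sym gc≡hd) , switcher⇒mobile swc refl (sym t≡hc)
        from-cycle (inj₂ (gc≡s , gd≡hc , t≡hd)) =
          g d , adj , cost≡2 , c , d , c≢d ,
          switcher⇒mobile swc gc≡s (sym gd≡hc) , switcher⇒mobile swd refl (sym t≡hd)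

-- Route the unit from s to t instead: as t is of type 2 it passes through i, via an (s,i)-mobile
-- agent b. Comparing the two moves, the (i,t)-mobile agent a, b and the agent y entering t would
-- all switch, which the cost bound forbids unless y = b; so y, hence m, starts at s.
intermediate≡source : ∀ {n k} {f : Allocation n k} {v u : Demand k} {t i m s : Fin k} →
  MaxSwitchCostAtMost f 2 → IsDemandVector n k v → IsDemandVector n k u →
  Type2With f v t i → IsIntermediate f i t m v u →
  s ≢ t → s ≢ i → lookup v s ≥ 1 → m ≡ s
intermediate≡source {n} {k} {f} {v} {u} {t} {i} {m} {s} msc dv du (a , type2)
    (adjᵘ , costᵘ , x , y , x≢y , mob-x@(xᵛ≡i , i≢m , xᵘ≡m) , mob-y@(yᵛ≡m , m≢t , yᵘ≡t)) s≢t s≢i vₛ≥1 =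
  compare-moves (type2 s s≢i w dw adjʷ)
  where
  w : Demand k
  w = move v s t
  adjʷ : Adjacent s t v w
  adjʷ = move-adjacent v s≢t vₛ≥1
  dw : IsDemandVector n k w
  dw = trans (sum-move v s t vₛ≥1) dv
  costᵘʷ : switchCost f u w ≤ 2
  costᵘʷ = msc u w du dw (adjacent⇒dist1≡2 {x = u} {w} (adjacent-reroute {v = v} {u} {w} adjᵘ adjʷ s≢i))
  fixed-by-u : ∀ {z} → z ≢ x → z ≢ y → f z v ≡ f z u
  fixed-by-u = unswitched f (≤-reflexive costᵘ) x≢y (mobile⇒switcher f mob-x) (mobile⇒switcher f mob-y)

  compare-moves : IsIntermediate f s t i v w × Mobile f a i t v w → m ≡ s
  compare-moves ((_ , costʷ , b , _ , _ , mob-b@(bᵛ≡s , _ , bʷ≡i) , _) , mob-a@(aᵛ≡i , i≢t , aʷ≡t)) = begin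
    m      ≡⟨ sym yᵛ≡m ⟩
    f y v  ≡⟨ cong (λ z → f z v) y≡b ⟩
    f b v  ≡⟨ bᵛ≡s ⟩
    s      ∎
    where
    a≢y : a ≢ y
    a≢y = at-distinct-tasks⇒≢ f aᵛ≡i yᵛ≡m i≢m
    a≢b : a ≢ b
    a≢b = at-distinct-tasks⇒≢ f aᵛ≡i bᵛ≡s (≢-sym s≢i)
    b≢x : b ≢ x
    b≢x = at-distinct-tasks⇒≢ f bᵛ≡s xᵛ≡i s≢i
    a-switches : f a u ≢ f a w
    a-switches aᵘ≡aʷ with a ≟ x
    ... | yes refl = m≢t (trans (sym xᵘ≡m) (trans aᵘ≡aʷ aʷ≡t))
    ... | no a≢x   = i≢t (trans (sym aᵛ≡i) (trans (fixed-by-u a≢x a≢y) (trans aᵘ≡aʷ aʷ≡t)))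
    b-switches : y ≢ b → f b u ≢ f b w
    b-switches y≢b bᵘ≡bʷ = s≢i (trans (sym bᵛ≡s) (trans (fixed-by-u b≢x (≢-sym y≢b)) (trans bᵘ≡bʷ bʷ≡i)))
    y-switches : y ≢ b → f y u ≢ f y w
    y-switches y≢b yᵘ≡yʷ = m≢t (trans (sym yᵛ≡m) (trans yᵛ≡yʷ (trans (sym yᵘ≡yʷ) yᵘ≡t)))
      where
      yᵛ≡yʷ : f y v ≡ f y w
      yᵛ≡yʷ = unswitched f (≤-reflexive costʷ) a≢b (mobile⇒switcher f mob-a) (mobile⇒switcher f mob-b)
                (≢-sym a≢y) y≢b
    y≡b : y ≡ b
    y≡b = decidable-stable (y ≟ b) λ y≢b →
      y-switches y≢b (unswitched f costᵘʷ a≢b a-switches (b-switches y≢b) (≢-sym a≢y) y≢b)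

lemma16 : (n k : ℕ) → n ≥ 4 → k ≥ 5 →
    (f : Allocation n k) → Valid f → MaxSwitchCostAtMost f 2 →
    (v : Demand k) → IsDemandVector n k v →
    (t i : Fin k) → Type2With f v t i →
    (s₁ s₂ : Fin k) → s₁ ≢ s₂ →
    s₁ ≢ t → s₁ ≢ i → s₂ ≢ t → s₂ ≢ i →
    lookup v s₁ ≥ 1 → lookup v s₂ ≥ 1 →
    (v' : Demand k) → IsDemandVector n k v' → Adjacent i t v v' →
    switchCost f v v' ≡ 1
lemma16 n k _ _ f valid msc v dv t i type2 s₁ s₂ s₁≢s₂ s₁≢t s₁≢i s₂≢t s₂≢i vₛ₁≥1 vₛ₂≥1 v' dv' adj =
  ≤2-≢0-≢2⇒≡1 (msc v v' dv dv' (adjacent⇒dist1≡2 {x = v} {v'} adj))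
              (adjacent⇒switchCost≢0 f valid dv dv' adj) cost≢2
  where
  ≤2-≢0-≢2⇒≡1 : ∀ {c} → c ≤ 2 → c ≢ 0 → c ≢ 2 → c ≡ 1
  ≤2-≢0-≢2⇒≡1 z≤n             c≢0 _   = ⊥-elim (c≢0 refl)
  ≤2-≢0-≢2⇒≡1 (s≤s z≤n)       _   _   = refl
  ≤2-≢0-≢2⇒≡1 (s≤s (s≤s z≤n)) _   c≢2 = ⊥-elim (c≢2 refl)
  cost≢2 : switchCost f v v' ≢ 2
  cost≢2 cost≡2 with adjacent-switchCost≡2⇒intermediate f valid dv dv' adj cost≡2
  ... | m , intermediate = s₁≢s₂ (trans (sym (source s₁≢t s₁≢i vₛ₁≥1)) (source s₂≢t s₂≢i vₛ₂≥1))
    where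
    source : ∀ {s} → s ≢ t → s ≢ i → lookup v s ≥ 1 → m ≡ s
    source = intermediate≡source msc dv dv' type2 intermediate
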